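{- For every odd $k \ge 5$, the graph $F_1(k)$ is word-representable.
   Context: A graph $G=(V,E)$ is word-representable if there is a word $w$ over $V$ such that for all distinct $a,b\in V$, $ab\in E$ iff $a$ and $b$ alternate in $w$ (the subsequence of $w$ formed by the occurrences of $a$ and $b$ is $abab\cdots$ or $baba\cdots$). For odd $k\ge5$, $F_1(k)$ is the split graph with clique $C=\{c_1,\dots,c_{k-1}\}$, independent set $I=\{b_1,b_2,a_1,\dots,a_{k-2}\}$, and $N(b_1)=\{c_1,\dots,c_{k-2}\}$, $N(b_2)=\{c_2,\dots,c_{k-1}\}$, $N(a_i)=\{c_i,c_{i+1}\}$ for $1\le i\le k-2$. -}

module Defs where

open import Data.Nat using (ℕ; suc; _∸_)
open import Data.Fin using (Fin; toℕ)
open import Data.List using (List; []; _∷_)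
open import Data.List.Membership.Propositional using (_∈_)
open import Data.List.Relation.Unary.Linked using (Linked)
open import Data.Product using (Σ; _×_)
open import Data.Sum using (_⊎_)
open import Data.Unit using (⊤)
open import Data.Empty using (⊥)
open import Function.Bundles using (_⇔_)
open import Relation.Nullary using (¬_; Dec; yes; no)
open import Relation.Binary.Definitions using (DecidableEquality)
open import Relation.Binary.PropositionalEquality using (_≡_; _≢_; refl)
import Data.Fin

module _ {V : Set} (_≟_ : DecidableEquality V) where

  restrict : V → V → List V → List V
  restrict x y [] = []
  restrict x y (z ∷ w) with z ≟ x | z ≟ y
  ... | no _ | no _ = restrict x y w
  ... | _    | _    = z ∷ restrict x y w

  -- x and y alternate in w: the restricted subsequence is xyxy… or yxyx…,
  -- i.e. no two consecutive letters of it are equal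
  Alternate : V → V → List V → Set
  Alternate x y w = Linked _≢_ (restrict x y w)

  -- G = (V, E) is word-representable: some word w over V (containing every
  -- letter, as in the standard definition) such that for distinct x, y,
  -- xy ∈ E iff x and y alternate in w
  WordRepresentable : (E : V → V → Set) → Set
  WordRepresentable E =
    Σ (List V) λ w →
      (∀ v → v ∈ w) ×
      (∀ x y → x ≢ y → (E x y ⇔ Alternate x y w))

-- The graph F₁(k) (indices 0-based)
-- c i  ↔ c_{i+1},  i < k-1 ;   a i ↔ a_{i+1},  i < k-2

data F₁V (k : ℕ) : Set where
  c  : Fin (k ∸ 1) → F₁V k
  b₁ : F₁V k
  b₂ : F₁V k
  a  : Fin (k ∸ 2) → F₁V k

AC : ∀ {k} → Fin (k ∸ 2) → Fin (k ∸ 1) → Set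
AC i j = (toℕ j ≡ toℕ i) ⊎ (toℕ j ≡ suc (toℕ i))

F₁E : (k : ℕ) → F₁V k → F₁V k → Set
F₁E k (c i) (c j) = i ≢ j
F₁E k (c i) b₁    = ¬ (suc (toℕ i) ≡ k ∸ 1)        -- N(b₁) = {c₁..c_{k-2}}
F₁E k (c i) b₂    = ¬ (toℕ i ≡ 0)                  -- N(b₂) = {c₂..c_{k-1}}
F₁E k (c j) (a i) = AC {k} i j
F₁E k b₁ (c i)    = ¬ (suc (toℕ i) ≡ k ∸ 1)
F₁E k b₂ (c i)    = ¬ (toℕ i ≡ 0)
F₁E k (a i) (c j) = AC {k} i j
F₁E k _ _         = ⊥

_≟F_ : ∀ {k} → DecidableEquality (F₁V k)
c i ≟F c j with i Data.Fin.≟ j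
... | yes refl = yes refl
... | no ne = no λ { refl → ne refl }
c _ ≟F b₁ = no λ ()
c _ ≟F b₂ = no λ ()
c _ ≟F a _ = no λ ()
b₁ ≟F c _ = no λ ()
b₁ ≟F b₁ = yes refl
b₁ ≟F b₂ = no λ ()
b₁ ≟F a _ = no λ ()
b₂ ≟F c _ = no λ ()
b₂ ≟F b₁ = no λ ()
b₂ ≟F b₂ = yes refl
b₂ ≟F a _ = no λ ()
a _ ≟F c _ = no λ ()
a _ ≟F b₁ = no λ ()
a _ ≟F b₂ = no λ ()
a i ≟F a j with i Data.Fin.≟ j
... | yes refl = yes refl
... | no ne = no λ { refl → ne refl }

-- F₁(k) is represented, for every k ≥ 3, by a word in which every vertex occurs exactly three
-- times.  In such a word two letters alternate when their occurrences interleave, and they do not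
-- as soon as two consecutive occurrences of one letter enclose no occurrence of the other.
-- Occurrences sit at positions 12t + o (slot o at time t).  The times 0 … 3(k-1) form three
-- rounds, in each of which c₁ … c_{k-1} appear in order, so C is a clique; b₁, b₂ and the a_i
-- are slotted in so that each interleaves exactly with its neighbours, the a_i with i odd
-- starting in the first round and those with i even in the second.

module Submission where

open import Defs
open import Data.Nat using (ℕ; _≤_; _%_)
open import Relation.Binary.PropositionalEquality using (_≡_)

open import Data.Bool using (T)
open import Data.Empty using (⊥; ⊥-elim)
open import Data.Fin using (Fin; toℕ; fromℕ<)
open import Data.Fin.Properties using (toℕ<n; fromℕ<-toℕ; toℕ-injective)
open import Data.List using (List; []; _∷_; _++_; mapMaybe)
open import Data.List.Properties using (mapMaybe-++; mapMaybe-cong)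
open import Data.List.Membership.Propositional using (_∈_; _∉_)
open import Data.List.Membership.Propositional.Properties using (∈-++⁺ʳ)
open import Data.List.Relation.Binary.Pointwise using (Pointwise; []; _∷_)
open import Data.List.Relation.Unary.All as All using (All; []; _∷_)
open import Data.List.Relation.Unary.Any using (here; there)
open import Data.List.Relation.Unary.Linked using (Linked; []; [-]; _∷_)
open import Data.Maybe using (Maybe; just; nothing; maybe′; _>>=_)
import Data.Nat as ℕ
open import Data.Nat using (zero; suc; _+_; _*_; _∸_; _<_; _<?_; _<ᵇ_; _≤ᵇ_; _/_; z≤n; s≤s; z<s; parity)
open import Data.Nat.DivMod using (+-distrib-/-∣ˡ; m*n/n≡m; m<n⇒m/n≡0; [m+kn]%n≡m%n; m<n⇒m%n≡m)
open import Data.Nat.Divisibility using (divides-refl)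
open import Data.Nat.Properties
open import Data.List.Membership.DecPropositional ℕ._≟_ using (_∈?_)
open import Data.Parity.Base using (Parity; 0ℙ; 1ℙ)
open import Data.Parity.Properties using (suc-homo-⁻¹; p≢p⁻¹)
open import Data.Product using (_×_; _,_)
open import Data.Sum using (_⊎_; inj₁; inj₂; [_,_]′)
open import Function using (id; _∘_; _$_)
open import Function.Bundles using (_⇔_; mk⇔; Equivalence)
open import Relation.Binary.Definitions using (DecidableEquality; tri<; tri≈; tri>)
open import Relation.Binary.PropositionalEquality using (refl; sym; trans; cong; cong₂; subst; _≢_; module ≡-Reasoning)
open import Relation.Nullary using (¬_; yes; no; contradiction)

module _ {A B C : Set} where

  mapMaybe-mapMaybe : ∀ (f : A → Maybe B) (g : B → Maybe C) xs →
                      mapMaybe g (mapMaybe f xs) ≡ mapMaybe (λ x → f x >>= g) xs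
  mapMaybe-mapMaybe f g [] = refl
  mapMaybe-mapMaybe f g (x ∷ xs) with f x
  ... | nothing = mapMaybe-mapMaybe f g xs
  ... | just y  = cong (maybe′ _∷_ id (g y)) (mapMaybe-mapMaybe f g xs)

module _ {A B : Set} (f : A → Maybe B) where

  mapMaybe-pointwise : ∀ {xs ys} → Pointwise (λ x y → f x ≡ just y) xs ys → mapMaybe f xs ≡ ys
  mapMaybe-pointwise [] = refl
  mapMaybe-pointwise (fx≡y ∷ rest) rewrite fx≡y = cong (_ ∷_) (mapMaybe-pointwise rest)

module _ {V : Set} where

  ¬Linked-repeat : ∀ u {x : V} v → ¬ Linked _≢_ (u ++ x ∷ x ∷ v)
  ¬Linked-repeat []          v (x≢x ∷ _) = x≢x refl
  ¬Linked-repeat (_ ∷ [])    v (_ ∷ l)   = ¬Linked-repeat [] v l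
  ¬Linked-repeat (_ ∷ z ∷ u) v (_ ∷ l)   = ¬Linked-repeat (z ∷ u) v l

module _ {V : Set} (_≟_ : DecidableEquality V) where

  select : V → V → V → Maybe V
  select x y z with z ≟ x | z ≟ y
  ... | no _ | no _ = nothing
  ... | _    | _    = just z

  select-left : ∀ x y → select x y x ≡ just x
  select-left x y with x ≟ x | x ≟ y
  ... | yes _  | _ = refl
  ... | no x≢x | _ = contradiction refl x≢x

  select-right : ∀ x y → select x y y ≡ just y
  select-right x y with y ≟ x | y ≟ y
  ... | yes _ | _      = refl
  ... | no _  | yes _  = refl
  ... | no _  | no y≢y = contradiction refl y≢y

  select-other : ∀ {x y z} → z ≢ x → z ≢ y → select x y z ≡ nothing
  select-other {x} {y} {z} z≢x z≢y with z ≟ x | z ≟ y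
  ... | yes z≡x | _       = contradiction z≡x z≢x
  ... | no _    | yes z≡y = contradiction z≡y z≢y
  ... | no _    | no _    = refl

  select-comm : ∀ x y z → select x y z ≡ select y x z
  select-comm x y z with z ≟ x | z ≟ y
  ... | yes _ | yes _ = refl
  ... | yes _ | no _  = refl
  ... | no _  | yes _ = refl
  ... | no _  | no _  = refl

  restrict≡mapMaybe-select : ∀ x y w → restrict _≟_ x y w ≡ mapMaybe (select x y) w
  restrict≡mapMaybe-select x y [] = refl
  restrict≡mapMaybe-select x y (z ∷ w) with z ≟ x | z ≟ y
  ... | yes _ | _     = cong (z ∷_) (restrict≡mapMaybe-select x y w)
  ... | no _  | yes _ = cong (z ∷_) (restrict≡mapMaybe-select x y w)
  ... | no _  | no _  = restrict≡mapMaybe-select x y w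

  restrict-++ : ∀ x y u v → restrict _≟_ x y (u ++ v) ≡ restrict _≟_ x y u ++ restrict _≟_ x y v
  restrict-++ x y u v = begin
    restrict _≟_ x y (u ++ v)                      ≡⟨ restrict≡mapMaybe-select x y (u ++ v) ⟩
    mapMaybe (select x y) (u ++ v)                 ≡⟨ mapMaybe-++ (select x y) u v ⟩
    mapMaybe (select x y) u ++ mapMaybe (select x y) v
      ≡⟨ sym (cong₂ _++_ (restrict≡mapMaybe-select x y u) (restrict≡mapMaybe-select x y v)) ⟩
    restrict _≟_ x y u ++ restrict _≟_ x y v       ∎
    where open ≡-Reasoning

  restrict-comm : ∀ x y w → restrict _≟_ x y w ≡ restrict _≟_ y x w
  restrict-comm x y w = begin
    restrict _≟_ x y w         ≡⟨ restrict≡mapMaybe-select x y w ⟩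
    mapMaybe (select x y) w    ≡⟨ mapMaybe-cong (select-comm x y) w ⟩
    mapMaybe (select y x) w    ≡⟨ sym (restrict≡mapMaybe-select y x w) ⟩
    restrict _≟_ y x w         ∎
    where open ≡-Reasoning

  alternate-comm : ∀ x y w → Alternate _≟_ x y w → Alternate _≟_ y x w
  alternate-comm x y w = subst (Linked _≢_) (restrict-comm x y w)

  ¬alternate-comm : ∀ x y w → ¬ Alternate _≟_ x y w → ¬ Alternate _≟_ y x w
  ¬alternate-comm x y w ¬alt = ¬alt ∘ alternate-comm y x w

interval : ℕ → ℕ → List ℕ
interval lo zero    = []
interval lo (suc d) = lo ∷ interval (suc lo) d

range : ℕ → ℕ → List ℕ
range lo hi = interval lo (hi ∸ lo)

interval-++ : ∀ lo d e → interval lo (d + e) ≡ interval lo d ++ interval (d + lo) e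
interval-++ lo zero    e = refl
interval-++ lo (suc d) e rewrite interval-++ (suc lo) d e | +-suc d lo = refl

∸-+-∸ : ∀ {lo mid hi} → lo ≤ mid → mid ≤ hi → (mid ∸ lo) + (hi ∸ mid) ≡ hi ∸ lo
∸-+-∸ {lo} {mid} {hi} lo≤mid mid≤hi = begin
  (mid ∸ lo) + (hi ∸ mid)              ≡⟨ m+n∸m≡n lo _ ⟨
  lo + ((mid ∸ lo) + (hi ∸ mid)) ∸ lo  ≡⟨ cong (_∸ lo) (+-assoc lo _ _) ⟨
  lo + (mid ∸ lo) + (hi ∸ mid) ∸ lo    ≡⟨ cong (λ t → t + (hi ∸ mid) ∸ lo) (m+[n∸m]≡n lo≤mid) ⟩
  mid + (hi ∸ mid) ∸ lo                ≡⟨ cong (_∸ lo) (m+[n∸m]≡n mid≤hi) ⟩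
  hi ∸ lo                              ∎
  where open ≡-Reasoning

range-++ : ∀ {lo mid hi} → lo ≤ mid → mid ≤ hi → range lo hi ≡ range lo mid ++ range mid hi
range-++ {lo} {mid} {hi} lo≤mid mid≤hi = begin
  interval lo (hi ∸ lo)
    ≡⟨ cong (interval lo) (∸-+-∸ lo≤mid mid≤hi) ⟨
  interval lo ((mid ∸ lo) + (hi ∸ mid))
    ≡⟨ interval-++ lo (mid ∸ lo) (hi ∸ mid) ⟩
  interval lo (mid ∸ lo) ++ interval ((mid ∸ lo) + lo) (hi ∸ mid)
    ≡⟨ cong (λ t → range lo mid ++ interval t (hi ∸ mid)) (m∸n+n≡m lo≤mid) ⟩
  range lo mid ++ range mid hi ∎
  where open ≡-Reasoning

range-∷ : ∀ {lo hi} → lo < hi → range lo hi ≡ lo ∷ range (suc lo) hi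
range-∷ {lo} {suc hi} (s≤s lo≤hi) = cong (interval lo) (+-∸-assoc 1 lo≤hi)

data Increasing : ℕ → ℕ → List ℕ → Set where
  []  : ∀ {lo hi} → lo ≤ hi → Increasing lo hi []
  _∷_ : ∀ {lo hi p ps} → lo ≤ p → Increasing (suc p) hi ps → Increasing lo hi (p ∷ ps)

Increasing⇒≤ : ∀ {lo hi ps} → Increasing lo hi ps → lo ≤ hi
Increasing⇒≤ ([] lo≤hi)     = lo≤hi
Increasing⇒≤ (lo≤p ∷ inc) = ≤-trans lo≤p (<⇒≤ (Increasing⇒≤ inc))

Increasing⇒∉ : ∀ {lo hi ps K} → Increasing lo hi ps → K < lo → K ∉ ps
Increasing⇒∉ (lo≤p ∷ _)   K<lo (here refl)  = <⇒≱ K<lo lo≤p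
Increasing⇒∉ (lo≤p ∷ inc) K<lo (there K∈ps) = Increasing⇒∉ inc (≤-trans K<lo (≤-trans lo≤p (n≤1+n _))) K∈ps

module _ {A : Set} (f : ℕ → Maybe A) where

  mapMaybe-interval-nothing : ∀ lo d → (∀ {K} → lo ≤ K → K < d + lo → f K ≡ nothing) →
                              mapMaybe f (interval lo d) ≡ []
  mapMaybe-interval-nothing lo zero    _     = refl
  mapMaybe-interval-nothing lo (suc d) quiet rewrite quiet ≤-refl (s≤s (m≤n+m lo d)) =
    mapMaybe-interval-nothing (suc lo) d
      (λ {K} lo<K K<hi → quiet (<⇒≤ lo<K) (subst (K <_) (+-suc d lo) K<hi))

  mapMaybe-range-nothing : ∀ {lo hi} → lo ≤ hi → (∀ {K} → lo ≤ K → K < hi → f K ≡ nothing) →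
                           mapMaybe f (range lo hi) ≡ []
  mapMaybe-range-nothing {lo} {hi} lo≤hi quiet =
    mapMaybe-interval-nothing lo (hi ∸ lo) (λ lo≤K K<hi → quiet lo≤K (subst (_ <_) (m∸n+n≡m lo≤hi) K<hi))

  mapMaybe-range-sparse : ∀ {lo hi ps} → Increasing lo hi ps →
                          (∀ {K} → lo ≤ K → K < hi → K ∉ ps → f K ≡ nothing) →
                          mapMaybe f (range lo hi) ≡ mapMaybe f ps
  mapMaybe-range-sparse ([] lo≤hi) quiet =
    mapMaybe-range-nothing lo≤hi (λ lo≤K K<hi → quiet lo≤K K<hi λ ())
  mapMaybe-range-sparse {lo} {hi} {p ∷ ps} (lo≤p ∷ inc) quiet = begin
    mapMaybe f (range lo hi)                                  ≡⟨ cong (mapMaybe f) (range-++ lo≤p (<⇒≤ p<hi)) ⟩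
    mapMaybe f (range lo p ++ range p hi)                     ≡⟨ mapMaybe-++ f (range lo p) _ ⟩
    mapMaybe f (range lo p) ++ mapMaybe f (range p hi)        ≡⟨ cong₂ _++_ before (cong (mapMaybe f) (range-∷ p<hi)) ⟩
    mapMaybe f (p ∷ range (suc p) hi)                         ≡⟨ cong (maybe′ _∷_ id (f p)) after ⟩
    mapMaybe f (p ∷ ps)                                       ∎
    where
    open ≡-Reasoning
    p<hi : p < hi
    p<hi = Increasing⇒≤ inc
    before : mapMaybe f (range lo p) ≡ []
    before = mapMaybe-range-nothing lo≤p λ lo≤K K<p →
      quiet lo≤K (<-trans K<p p<hi) (Increasing⇒∉ (≤-refl ∷ inc) K<p)
    after : mapMaybe f (range (suc p) hi) ≡ mapMaybe f ps
    after = mapMaybe-range-sparse inc λ p<K K<hi K∉ps → quiet (≤-trans lo≤p (<⇒≤ p<K)) K<hi λ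
      { (here refl) → <-irrefl refl p<K ; (there K∈ps) → K∉ps K∈ps }

Outside : ℕ → ℕ → ℕ → Set
Outside p q K = K ≤ p ⊎ q ≤ K

module Occurrences {V : Set} (_≟_ : DecidableEquality V)
  (owner : ℕ → Maybe V) (keys : V → List ℕ) (N : ℕ)
  (owner-sound    : ∀ {K v} → owner K ≡ just v → K ∈ keys v)
  (owner-complete : ∀ {K v} → K ∈ keys v → owner K ≡ just v)
  (keys-below     : ∀ {K v} → K ∈ keys v → K < N)
  where

  spell : ℕ → ℕ → List V
  spell lo hi = mapMaybe owner (range lo hi)

  word : List V
  word = spell 0 N

  ∈-word : ∀ {K v} → K ∈ keys v → v ∈ word
  ∈-word {K} {v} K∈v = subst (v ∈_) (sym word≡) (∈-++⁺ʳ (spell 0 K) v∈)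
    where
    K<N = keys-below K∈v
    word≡ : word ≡ spell 0 K ++ mapMaybe owner (K ∷ range (suc K) N)
    word≡ = trans (cong (mapMaybe owner) (trans (range-++ z≤n (<⇒≤ K<N)) (cong (range 0 K ++_) (range-∷ K<N))))
                  (mapMaybe-++ owner (range 0 K) _)
    v∈ : v ∈ mapMaybe owner (K ∷ range (suc K) N)
    v∈ rewrite owner-complete K∈v = here refl

  owner-selects : V → V → ℕ → Maybe V
  owner-selects x y K = owner K >>= select _≟_ x y

  selects-left : ∀ {x y K} → K ∈ keys x → owner-selects x y K ≡ just x
  selects-left {x} {y} K∈x rewrite owner-complete K∈x = select-left _≟_ x y

  selects-right : ∀ {x y K} → K ∈ keys y → owner-selects x y K ≡ just y
  selects-right {x} {y} K∈y rewrite owner-complete K∈y = select-right _≟_ x y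

  restrict-spell : ∀ {x y lo hi ps} → Increasing lo hi ps →
                   (∀ {K} → lo ≤ K → K < hi → K ∈ keys x ⊎ K ∈ keys y → K ∈ ps) →
                   restrict _≟_ x y (spell lo hi) ≡ mapMaybe (owner-selects x y) ps
  restrict-spell {x} {y} {lo} {hi} {ps} inc covers = begin
    restrict _≟_ x y (spell lo hi)                          ≡⟨ restrict≡mapMaybe-select _≟_ x y (spell lo hi) ⟩
    mapMaybe (select _≟_ x y) (spell lo hi)                 ≡⟨ mapMaybe-mapMaybe owner (select _≟_ x y) (range lo hi) ⟩
    mapMaybe (owner-selects x y) (range lo hi)              ≡⟨ mapMaybe-range-sparse (owner-selects x y) inc quiet ⟩
    mapMaybe (owner-selects x y) ps                         ∎
    where
    open ≡-Reasoning
    quiet : ∀ {K} → lo ≤ K → K < hi → K ∉ ps → owner-selects x y K ≡ nothing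
    quiet {K} lo≤K K<hi K∉ps with owner K in eq
    ... | nothing = refl
    ... | just z  = select-other _≟_
      (λ { refl → K∉ps (covers lo≤K K<hi (inj₁ (owner-sound eq))) })
      (λ { refl → K∉ps (covers lo≤K K<hi (inj₂ (owner-sound eq))) })

  interleaved⇒alternate : ∀ x y {x₁ x₂ x₃ y₁ y₂ y₃} → x ≢ y →
    keys x ≡ x₁ ∷ x₂ ∷ x₃ ∷ [] → keys y ≡ y₁ ∷ y₂ ∷ y₃ ∷ [] →
    x₁ < y₁ → y₁ < x₂ → x₂ < y₂ → y₂ < x₃ → x₃ < y₃ →
    Alternate _≟_ x y word
  interleaved⇒alternate x y {x₁} {x₂} {x₃} {y₁} {y₂} {y₃} x≢y kx ky c₁ c₂ c₃ c₄ c₅ =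
    subst (Linked _≢_) (sym restricted) (x≢y ∷ y≢x ∷ x≢y ∷ y≢x ∷ x≢y ∷ [-])
    where
    y≢x : y ≢ x
    y≢x = x≢y ∘ sym
    in-x : ∀ {K} → K ∈ x₁ ∷ x₂ ∷ x₃ ∷ [] → K ∈ keys x
    in-x = subst (_ ∈_) (sym kx)
    in-y : ∀ {K} → K ∈ y₁ ∷ y₂ ∷ y₃ ∷ [] → K ∈ keys y
    in-y = subst (_ ∈_) (sym ky)
    merged : ∀ {K} → K ∈ keys x ⊎ K ∈ keys y → K ∈ x₁ ∷ y₁ ∷ x₂ ∷ y₂ ∷ x₃ ∷ y₃ ∷ []
    merged (inj₁ K∈x) with subst (_ ∈_) kx K∈x
    ... | here refl                 = here refl
    ... | there (here refl)         = there (there (here refl))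
    ... | there (there (here refl)) = there (there (there (there (here refl))))
    merged (inj₂ K∈y) with subst (_ ∈_) ky K∈y
    ... | here refl                 = there (here refl)
    ... | there (here refl)         = there (there (there (here refl)))
    ... | there (there (here refl)) = there (there (there (there (there (here refl)))))
    restricted : restrict _≟_ x y word ≡ x ∷ y ∷ x ∷ y ∷ x ∷ y ∷ []
    restricted = trans
      (restrict-spell (z≤n ∷ c₁ ∷ c₂ ∷ c₃ ∷ c₄ ∷ c₅ ∷ [] (keys-below (in-y (there (there (here refl))))))
                      (λ _ _ → merged))
      (mapMaybe-pointwise (owner-selects x y)
        ( selects-left (in-x (here refl)) ∷ selects-right (in-y (here refl))
        ∷ selects-left (in-x (there (here refl))) ∷ selects-right (in-y (there (here refl)))
        ∷ selects-left (in-x (there (there (here refl)))) ∷ selects-right (in-y (there (there (here refl))))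
        ∷ []))

  gap⇒¬alternate : ∀ {x y p q} → p ∈ keys x → q ∈ keys x → p < q →
                   All (Outside p q) (keys x) → All (Outside p q) (keys y) →
                   ¬ Alternate _≟_ x y word
  gap⇒¬alternate {x} {y} {p} {q} p∈x q∈x p<q out-x out-y =
    subst (λ l → ¬ Linked _≢_ l) (sym restricted) (¬Linked-repeat (restrict _≟_ x y (spell 0 p)) _)
    where
    q<N = keys-below q∈x
    pinned : ∀ {K} → p ≤ K → K < suc q → Outside p q K → K ∈ p ∷ q ∷ []
    pinned p≤K _     (inj₁ K≤p) = here (≤-antisym K≤p p≤K)
    pinned _   K<1+q (inj₂ q≤K) = there (here (≤-antisym (≤-pred K<1+q) q≤K))
    middle : restrict _≟_ x y (spell p (suc q)) ≡ x ∷ x ∷ []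
    middle = trans
      (restrict-spell (≤-refl ∷ p<q ∷ [] ≤-refl)
        (λ { p≤K K<1+q (inj₁ K∈x) → pinned p≤K K<1+q (All.lookup out-x K∈x)
           ; p≤K K<1+q (inj₂ K∈y) → pinned p≤K K<1+q (All.lookup out-y K∈y) }))
      (mapMaybe-pointwise (owner-selects x y) (selects-left p∈x ∷ selects-left q∈x ∷ []))
    word-split : word ≡ spell 0 p ++ spell p (suc q) ++ spell (suc q) N
    word-split = begin
      mapMaybe owner (range 0 N)
        ≡⟨ cong (mapMaybe owner) (range-++ z≤n (≤-trans (<⇒≤ p<q) (<⇒≤ q<N))) ⟩
      mapMaybe owner (range 0 p ++ range p N)
        ≡⟨ mapMaybe-++ owner (range 0 p) _ ⟩
      spell 0 p ++ mapMaybe owner (range p N)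
        ≡⟨ cong (λ l → spell 0 p ++ mapMaybe owner l) (range-++ (m≤n⇒m≤1+n (<⇒≤ p<q)) q<N) ⟩
      spell 0 p ++ mapMaybe owner (range p (suc q) ++ range (suc q) N)
        ≡⟨ cong (spell 0 p ++_) (mapMaybe-++ owner (range p (suc q)) _) ⟩
      spell 0 p ++ spell p (suc q) ++ spell (suc q) N ∎
      where open ≡-Reasoning
    restricted : restrict _≟_ x y word ≡ restrict _≟_ x y (spell 0 p) ++ x ∷ x ∷ restrict _≟_ x y (spell (suc q) N)
    restricted = begin
      restrict _≟_ x y word
        ≡⟨ cong (restrict _≟_ x y) word-split ⟩
      restrict _≟_ x y (spell 0 p ++ spell p (suc q) ++ spell (suc q) N)
        ≡⟨ restrict-++ _≟_ x y (spell 0 p) _ ⟩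
      restrict _≟_ x y (spell 0 p) ++ restrict _≟_ x y (spell p (suc q) ++ spell (suc q) N)
        ≡⟨ cong (restrict _≟_ x y (spell 0 p) ++_) (restrict-++ _≟_ x y (spell p (suc q)) _) ⟩
      restrict _≟_ x y (spell 0 p) ++ restrict _≟_ x y (spell p (suc q)) ++ restrict _≟_ x y (spell (suc q) N)
        ≡⟨ cong (λ l → restrict _≟_ x y (spell 0 p) ++ l ++ restrict _≟_ x y (spell (suc q) N)) middle ⟩
      restrict _≟_ x y (spell 0 p) ++ x ∷ x ∷ restrict _≟_ x y (spell (suc q) N) ∎
      where open ≡-Reasoning

  first-gap⇒¬alternate : ∀ x y {x₁ x₂ x₃ ys} → keys x ≡ x₁ ∷ x₂ ∷ x₃ ∷ [] → x₁ < x₂ → x₂ < x₃ →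
                         keys y ≡ ys → All (Outside x₁ x₂) ys → ¬ Alternate _≟_ x y word
  first-gap⇒¬alternate x y kx x₁<x₂ x₂<x₃ ky out-y =
    gap⇒¬alternate (subst (_ ∈_) (sym kx) (here refl)) (subst (_ ∈_) (sym kx) (there (here refl))) x₁<x₂
      (subst (All _) (sym kx) (inj₁ ≤-refl ∷ inj₂ ≤-refl ∷ inj₂ (<⇒≤ x₂<x₃) ∷ []))
      (subst (All _) (sym ky) out-y)

  second-gap⇒¬alternate : ∀ x y {x₁ x₂ x₃ ys} → keys x ≡ x₁ ∷ x₂ ∷ x₃ ∷ [] → x₁ < x₂ → x₂ < x₃ →
                          keys y ≡ ys → All (Outside x₂ x₃) ys → ¬ Alternate _≟_ x y word
  second-gap⇒¬alternate x y kx x₁<x₂ x₂<x₃ ky out-y =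
    gap⇒¬alternate (subst (_ ∈_) (sym kx) (there (here refl))) (subst (_ ∈_) (sym kx) (there (there (here refl)))) x₂<x₃
      (subst (All _) (sym kx) (inj₁ (<⇒≤ x₁<x₂) ∷ inj₁ ≤-refl ∷ inj₂ ≤-refl ∷ []))
      (subst (All _) (sym ky) out-y)

-- Position of slot o at time t.  κ is opaque so that unification can read t and o back off
-- κ t o, which lets the order lemmas below be used with all arguments implicit.
opaque
  κ : ℕ → ℕ → ℕ
  κ t o = t * 12 + o

opaque
  unfolding κ
  κ-mono-≤ : ∀ {t t′ o o′} {_ : T (o ≤ᵇ o′)} → t ≤ t′ → κ t o ≤ κ t′ o′
  κ-mono-≤ {t} {t′} {o} {o′} {o≤o′} t≤t′ = +-mono-≤ (*-monoˡ-≤ 12 t≤t′) (≤ᵇ⇒≤ o o′ o≤o′)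

  κ-mono-< : ∀ {t t′ o o′} {_ : T (o <ᵇ o′)} → t ≤ t′ → κ t o < κ t′ o′
  κ-mono-< {t} {t′} {o} {o′} {o<o′} t≤t′ = +-mono-≤-< (*-monoˡ-≤ 12 t≤t′) (<ᵇ⇒< o o′ o<o′)

  κ-monoˡ-< : ∀ {t t′ o o′} {o<12 : T (o <ᵇ 12)} → t < t′ → κ t o < κ t′ o′
  κ-monoˡ-< {t} {t′} {o} {o′} {o<12} t<t′ = begin-strict
    t * 12 + o    <⟨ +-monoʳ-< (t * 12) (<ᵇ⇒< o 12 o<12) ⟩
    t * 12 + 12   ≡⟨ +-comm (t * 12) 12 ⟩
    suc t * 12    ≤⟨ *-monoˡ-≤ 12 t<t′ ⟩
    t′ * 12       ≤⟨ m≤m+n (t′ * 12) o′ ⟩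
    t′ * 12 + o′  ∎
    where open ≤-Reasoning

  κ-div : ∀ t {o} → o < 12 → κ t o / 12 ≡ t
  κ-div t {o} o<12 = begin
    (t * 12 + o) / 12     ≡⟨ +-distrib-/-∣ˡ o (divides-refl t) ⟩
    t * 12 / 12 + o / 12  ≡⟨ cong₂ _+_ (m*n/n≡m t 12) (m<n⇒m/n≡0 o<12) ⟩
    t + 0                 ≡⟨ +-identityʳ t ⟩
    t                     ∎
    where open ≡-Reasoning

  κ-mod : ∀ t {o} → o < 12 → κ t o % 12 ≡ o
  κ-mod t {o} o<12 = begin
    (t * 12 + o) % 12  ≡⟨ cong (_% 12) (+-comm (t * 12) o) ⟩
    (o + t * 12) % 12  ≡⟨ [m+kn]%n≡m%n o t 12 ⟩
    o % 12             ≡⟨ m<n⇒m%n≡m o<12 ⟩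
    o                  ∎
    where open ≡-Reasoning

same-parity⇒2+≤ : ∀ {u v} → parity u ≡ parity v → u < v → 2 + u ≤ v
same-parity⇒2+≤ {u} {v} same u<v = ≤∧≢⇒< u<v λ { refl → p≢p⁻¹ (parity (suc u)) (sym (trans (suc-homo-⁻¹ u) same)) }

near⇒bounds : ∀ {r j} → r ≡ j ⊎ r ≡ suc j → j ≤ r × r < 2 + j
near⇒bounds {j = j} (inj₁ refl) = ≤-refl , m<n+m j z<s
near⇒bounds {j = j} (inj₂ refl) = n≤1+n j , ≤-refl

near-or-apart : ∀ r j → (r ≡ j ⊎ r ≡ suc j) ⊎ (r < j ⊎ 2 + j ≤ r)
near-or-apart r j with <-cmp r j
... | tri< r<j _ _ = inj₂ (inj₁ r<j)
... | tri≈ _ r≡j _ = inj₁ (inj₁ r≡j)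
... | tri> _ _ j<r with r ℕ.≟ suc j
...   | yes r≡1+j = inj₁ (inj₂ r≡1+j)
...   | no r≢1+j  = inj₂ (inj₂ (≤∧≢⇒< j<r (r≢1+j ∘ sym)))

module F₁Word (m : ℕ) where

  k n last : ℕ
  k    = suc (suc (suc m))
  n    = suc (suc m)
  last = suc m

  cAt : ℕ → Maybe (F₁V k)
  cAt r with r <? n
  ... | yes r<n = just (c (fromℕ< r<n))
  ... | no _    = nothing

  aAt : ℕ → Maybe (F₁V k)
  aAt j with j <? last
  ... | yes j<last = just (a (fromℕ< j<last))
  ... | no _       = nothing

  cAt-toℕ : ∀ i → cAt (toℕ i) ≡ just (c i)
  cAt-toℕ i with toℕ i <? n
  ... | yes i<n = cong (just ∘ c) (fromℕ<-toℕ i i<n)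
  ... | no i≮n  = contradiction (toℕ<n i) i≮n

  aAt-toℕ : ∀ i → aAt (toℕ i) ≡ just (a i)
  aAt-toℕ i with toℕ i <? last
  ... | yes i<last = cong (just ∘ a) (fromℕ<-toℕ i i<last)
  ... | no i≮last  = contradiction (toℕ<n i) i≮last

  -- a i is the paper's a_{i+1}, so parity 0ℙ is an odd index there.
  aKeys : Parity → ℕ → List ℕ
  aKeys 0ℙ j = κ j 6 ∷ κ (2 + j) 2 ∷ κ (n + (2 + j)) 4 ∷ []
  aKeys 1ℙ j = κ (n + j) 7 ∷ κ (n + (2 + j)) 3 ∷ κ (n + n + (2 + j)) 5 ∷ []

  keys : F₁V k → List ℕ
  keys (c i) = κ (toℕ i) 9 ∷ κ (n + toℕ i) 10 ∷ κ (n + n + toℕ i) 11 ∷ []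
  keys b₁    = κ 0 0 ∷ κ last 0 ∷ κ (n + n) 8 ∷ []
  keys b₂    = κ n 1 ∷ κ (suc (n + n)) 1 ∷ κ (n + n + n) 1 ∷ []
  keys (a i) = aKeys (parity (toℕ i)) (toℕ i)

  -- Only a candidate (slot 2 names a (t ∸ 2) whatever its parity); owner keeps it only if the
  -- position is one of its keys.
  slot : ℕ → ℕ → Maybe (F₁V k)
  slot t 0  = just b₁
  slot t 1  = just b₂
  slot t 2  = aAt (t ∸ 2)
  slot t 3  = aAt (t ∸ n ∸ 2)
  slot t 4  = aAt (t ∸ n ∸ 2)
  slot t 5  = aAt (t ∸ (n + n) ∸ 2)
  slot t 6  = aAt t
  slot t 7  = aAt (t ∸ n)
  slot t 8  = just b₁
  slot t 9  = cAt t
  slot t 10 = cAt (t ∸ n)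
  slot t 11 = cAt (t ∸ (n + n))
  slot t _  = nothing

  decode : ℕ → Maybe (F₁V k)
  decode K = slot (K / 12) (K % 12)

  decode-κ : ∀ t {o} {_ : T (o <ᵇ 12)} → decode (κ t o) ≡ slot t o
  decode-κ t {o} {o<12} = cong₂ slot (κ-div t (<ᵇ⇒< o 12 o<12)) (κ-mod t (<ᵇ⇒< o 12 o<12))

  decode-keys : ∀ v → All (λ K → decode K ≡ just v) (keys v)
  decode-keys (c i) =
      trans (decode-κ r) (cAt-toℕ i)
    ∷ trans (decode-κ (n + r)) (trans (cong cAt (m+n∸m≡n n r)) (cAt-toℕ i))
    ∷ trans (decode-κ (n + n + r)) (trans (cong cAt (m+n∸m≡n (n + n) r)) (cAt-toℕ i))
    ∷ []
    where r = toℕ i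
  decode-keys b₁ = decode-κ 0 ∷ decode-κ last ∷ decode-κ (n + n) ∷ []
  decode-keys b₂ = decode-κ n ∷ decode-κ (suc (n + n)) ∷ decode-κ (n + n + n) ∷ []
  decode-keys (a i) with parity (toℕ i)
  ... | 0ℙ =
      trans (decode-κ j) (aAt-toℕ i)
    ∷ trans (decode-κ (2 + j)) (aAt-toℕ i)
    ∷ trans (decode-κ (n + (2 + j))) (trans (cong (λ t → aAt (t ∸ 2)) (m+n∸m≡n n (2 + j))) (aAt-toℕ i))
    ∷ []
    where j = toℕ i
  ... | 1ℙ =
      trans (decode-κ (n + j)) (trans (cong aAt (m+n∸m≡n n j)) (aAt-toℕ i))
    ∷ trans (decode-κ (n + (2 + j))) (trans (cong (λ t → aAt (t ∸ 2)) (m+n∸m≡n n (2 + j))) (aAt-toℕ i))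
    ∷ trans (decode-κ (n + n + (2 + j))) (trans (cong (λ t → aAt (t ∸ 2)) (m+n∸m≡n (n + n) (2 + j))) (aAt-toℕ i))
    ∷ []
    where j = toℕ i

  claim : ℕ → F₁V k → Maybe (F₁V k)
  claim K v with K ∈? keys v
  ... | yes _ = just v
  ... | no _  = nothing

  owner : ℕ → Maybe (F₁V k)
  owner K = decode K >>= claim K

  owner-sound : ∀ {K v} → owner K ≡ just v → K ∈ keys v
  owner-sound {K} eq with decode K
  ... | just u with K ∈? keys u
  owner-sound refl | just u | yes K∈u = K∈u

  owner-complete : ∀ {K v} → K ∈ keys v → owner K ≡ just v
  owner-complete {K} {v} K∈v with decode K | All.lookup (decode-keys v) K∈v
  ... | .(just v) | refl with K ∈? keys v
  ...   | yes _   = refl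
  ...   | no K∉v  = contradiction K∈v K∉v

  N : ℕ
  N = κ (suc (n + n + n)) 0

  1+2n≡2n+1 : suc (n + n) ≡ n + n + 1
  1+2n≡2n+1 = +-comm 1 (n + n)

  1+2n<3n : suc (n + n) < n + n + n
  1+2n<3n = subst (_< n + n + n) (sym 1+2n≡2n+1) (+-monoʳ-< (n + n) (s≤s (s≤s z≤n)))

  last≤n+ : ∀ r → last ≤ n + r
  last≤n+ r = ≤-trans (n≤1+n last) (m≤m+n n r)

  n+-≤-n+n+ : ∀ {x y} → x ≤ n + y → n + x ≤ n + n + y
  n+-≤-n+n+ {x} {y} x≤n+y = subst (n + x ≤_) (sym (+-assoc n n y)) (+-monoʳ-≤ n x≤n+y)

  n+-<-n+n+ : ∀ {x y} → x < n + y → n + x < n + n + y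
  n+-<-n+n+ {x} {y} x<n+y = subst (n + x <_) (sym (+-assoc n n y)) (+-monoʳ-< n x<n+y)

  ≤3n : ∀ {x} → x ≤ n → x ≤ n + n + n
  ≤3n x≤n = ≤-trans x≤n (≤-trans (m≤m+n n n) (m≤m+n (n + n) n))

  n+≤3n : ∀ {x} → x ≤ n → n + x ≤ n + n + n
  n+≤3n x≤n = ≤-trans (+-monoʳ-≤ n x≤n) (m≤m+n (n + n) n)

  n+n+≤3n : ∀ {x} → x ≤ n → n + n + x ≤ n + n + n
  n+n+≤3n = +-monoʳ-≤ (n + n)

  below : ∀ {t o} {o<12 : T (o <ᵇ 12)} → t ≤ n + n + n → κ t o < N
  below {o<12 = o<12} t≤3n = κ-monoˡ-< {o<12 = o<12} (s≤s t≤3n)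

  keys<N : ∀ v → All (_< N) (keys v)
  keys<N (c i) = below (≤3n r≤n) ∷ below (n+≤3n r≤n) ∷ below (n+n+≤3n r≤n) ∷ []
    where r≤n = <⇒≤ (toℕ<n i)
  keys<N b₁ = below z≤n ∷ below (≤3n (n≤1+n last)) ∷ below (m≤m+n (n + n) n) ∷ []
  keys<N b₂ = below (≤3n ≤-refl) ∷ below (<⇒≤ 1+2n<3n) ∷ below ≤-refl ∷ []
  keys<N (a i) with parity (toℕ i)
  ... | 0ℙ = below (≤3n j≤n) ∷ below (≤3n 2+j≤n) ∷ below (n+≤3n 2+j≤n) ∷ []
    where
    j≤n = ≤-trans (<⇒≤ (toℕ<n i)) (n≤1+n last)
    2+j≤n = s≤s (toℕ<n i)
  ... | 1ℙ = below (n+≤3n j≤n) ∷ below (n+≤3n 2+j≤n) ∷ below (n+n+≤3n 2+j≤n) ∷ []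
    where
    j≤n = ≤-trans (<⇒≤ (toℕ<n i)) (n≤1+n last)
    2+j≤n = s≤s (toℕ<n i)

  open Occurrences (_≟F_ {k}) owner keys N owner-sound owner-complete (λ {_} {v} → All.lookup (keys<N v))

  Alt : F₁V k → F₁V k → Set
  Alt x y = Alternate _≟F_ x y word

  b₁-ordered₁₂ : κ 0 0 < κ last 0
  b₁-ordered₁₂ = κ-monoˡ-< z<s

  b₁-ordered₂₃ : κ last 0 < κ (n + n) 8
  b₁-ordered₂₃ = κ-mono-< (last≤n+ n)

  b₂-ordered₁₂ : κ n 1 < κ (suc (n + n)) 1
  b₂-ordered₁₂ = κ-monoˡ-< (s≤s (m≤m+n n n))

  b₂-ordered₂₃ : κ (suc (n + n)) 1 < κ (n + n + n) 1
  b₂-ordered₂₃ = κ-monoˡ-< 1+2n<3n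

  alternate-c-c : ∀ (i i′ : Fin n) → toℕ i < toℕ i′ → Alt (c i) (c i′)
  alternate-c-c i i′ r<s = interleaved⇒alternate (c i) (c i′) (λ { refl → <-irrefl refl r<s }) refl refl
    (κ-monoˡ-< r<s)
    (κ-monoˡ-< s<n+r)
    (κ-monoˡ-< (+-monoʳ-< n r<s))
    (κ-monoˡ-< (n+-<-n+n+ s<n+r))
    (κ-monoˡ-< (+-monoʳ-< (n + n) r<s))
    where
    r = toℕ i
    s<n+r = <-≤-trans (toℕ<n i′) (m≤m+n n r)

  alternate-b₁-c : ∀ (i : Fin n) → toℕ i < last → Alt b₁ (c i)
  alternate-b₁-c i r<last = interleaved⇒alternate b₁ (c i) (λ ()) refl refl
    (κ-mono-< z≤n)
    (κ-monoˡ-< r<last)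
    (κ-mono-< (last≤n+ r))
    (κ-monoˡ-< (+-monoʳ-< n (toℕ<n i)))
    (κ-mono-< (m≤m+n (n + n) r))
    where r = toℕ i

  ¬alternate-b₁-c : ∀ (i : Fin n) → toℕ i ≡ last → ¬ Alt b₁ (c i)
  ¬alternate-b₁-c i r≡last = first-gap⇒¬alternate b₁ (c i) refl b₁-ordered₁₂ b₁-ordered₂₃ refl
    ( inj₂ (κ-mono-≤ (≤-reflexive (sym r≡last)))
    ∷ inj₂ (κ-mono-≤ (last≤n+ r))
    ∷ inj₂ (κ-mono-≤ (≤-trans (last≤n+ n) (m≤m+n (n + n) r)))
    ∷ [])
    where r = toℕ i

  ¬alternate-b₁-b₂ : ¬ Alt b₁ b₂
  ¬alternate-b₁-b₂ = first-gap⇒¬alternate b₁ b₂ refl b₁-ordered₁₂ b₁-ordered₂₃ refl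
    ( inj₂ (κ-mono-≤ (n≤1+n last))
    ∷ inj₂ (κ-mono-≤ (≤-trans (last≤n+ n) (n≤1+n _)))
    ∷ inj₂ (κ-mono-≤ (≤-trans (last≤n+ n) (m≤m+n (n + n) n)))
    ∷ [])

  alternate-c-b₂ : ∀ (i : Fin n) → 1 ≤ toℕ i → Alt (c i) b₂
  alternate-c-b₂ i 1≤r = interleaved⇒alternate (c i) b₂ (λ ()) refl refl
    (κ-monoˡ-< (toℕ<n i))
    (κ-mono-< (m≤m+n n r))
    (κ-monoˡ-< (s≤s (+-monoʳ-≤ n (<⇒≤ (toℕ<n i)))))
    (κ-mono-< (subst (_≤ n + n + r) (sym 1+2n≡2n+1) (+-monoʳ-≤ (n + n) 1≤r)))
    (κ-monoˡ-< (+-monoʳ-< (n + n) (toℕ<n i)))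
    where r = toℕ i

  ¬alternate-b₂-c : ∀ (i : Fin n) → toℕ i ≡ 0 → ¬ Alt b₂ (c i)
  ¬alternate-b₂-c i r≡0 = second-gap⇒¬alternate b₂ (c i) refl b₂-ordered₁₂ b₂-ordered₂₃ refl
    ( inj₁ (<⇒≤ (κ-monoˡ-< (s≤s r≤)))
    ∷ inj₁ (<⇒≤ (κ-monoˡ-< (s≤s (+-monoʳ-≤ n r≤))))
    ∷ inj₁ (<⇒≤ (κ-monoˡ-< (s≤s (≤-reflexive (trans (cong (n + n +_) r≡0) (+-identityʳ (n + n)))))))
    ∷ [])
    where
    r = toℕ i
    r≤ : ∀ {b} → r ≤ b
    r≤ = ≤-trans (≤-reflexive r≡0) z≤n

  keys-a-even : ∀ i → parity (toℕ i) ≡ 0ℙ → keys (a i) ≡ aKeys 0ℙ (toℕ i)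
  keys-a-even i = cong (λ p → aKeys p (toℕ i))

  keys-a-odd : ∀ i → parity (toℕ i) ≡ 1ℙ → keys (a i) ≡ aKeys 1ℙ (toℕ i)
  keys-a-odd i = cong (λ p → aKeys p (toℕ i))

  module _ (i : Fin last) where

    private
      j = toℕ i

    2+j≤n : 2 + j ≤ n
    2+j≤n = s≤s (toℕ<n i)

    j<2+j : j < 2 + j
    j<2+j = m<n+m j z<s

    even-ordered₁₂ : κ j 6 < κ (2 + j) 2
    even-ordered₁₂ = κ-monoˡ-< j<2+j

    even-ordered₂₃ : κ (2 + j) 2 < κ (n + (2 + j)) 4
    even-ordered₂₃ = κ-mono-< (m≤n+m (2 + j) n)

    odd-ordered₁₂ : κ (n + j) 7 < κ (n + (2 + j)) 3
    odd-ordered₁₂ = κ-monoˡ-< (+-monoʳ-< n j<2+j)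

    odd-ordered₂₃ : κ (n + (2 + j)) 3 < κ (n + n + (2 + j)) 5
    odd-ordered₂₃ = κ-mono-< (+-monoˡ-≤ (2 + j) (m≤m+n n n))

    alternate-a-c-even : parity j ≡ 0ℙ → ∀ (i′ : Fin n) → j ≤ toℕ i′ → toℕ i′ < 2 + j → Alt (a i) (c i′)
    alternate-a-c-even even i′ j≤r r<2+j = interleaved⇒alternate (a i) (c i′) (λ ()) (keys-a-even i even) refl
      (κ-mono-< j≤r)
      (κ-monoˡ-< r<2+j)
      (κ-mono-< (≤-trans 2+j≤n (m≤m+n n r)))
      (κ-monoˡ-< (+-monoʳ-< n r<2+j))
      (κ-mono-< (n+-≤-n+n+ (≤-trans 2+j≤n (m≤m+n n r))))
      where r = toℕ i′

    alternate-c-a-odd : parity j ≡ 1ℙ → ∀ (i′ : Fin n) → j ≤ toℕ i′ → toℕ i′ < 2 + j → Alt (c i′) (a i)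
    alternate-c-a-odd odd i′ j≤r r<2+j = interleaved⇒alternate (c i′) (a i) (λ ()) refl (keys-a-odd i odd)
      (κ-monoˡ-< (<-≤-trans (toℕ<n i′) (m≤m+n n j)))
      (κ-mono-< (+-monoʳ-≤ n j≤r))
      (κ-monoˡ-< (+-monoʳ-< n r<2+j))
      (κ-mono-< (n+-≤-n+n+ (≤-trans 2+j≤n (m≤m+n n r))))
      (κ-monoˡ-< (+-monoʳ-< (n + n) r<2+j))
      where r = toℕ i′

    ¬alternate-a-c : ∀ (i′ : Fin n) → toℕ i′ < j ⊎ 2 + j ≤ toℕ i′ → ¬ Alt (a i) (c i′)
    ¬alternate-a-c i′ apart with parity j in eq
    ... | 0ℙ = first-gap⇒¬alternate (a i) (c i′) (keys-a-even i eq) even-ordered₁₂ even-ordered₂₃ refl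
      ( [ (λ r<j → inj₁ (<⇒≤ (κ-monoˡ-< r<j))) , (λ 2+j≤r → inj₂ (κ-mono-≤ 2+j≤r)) ]′ apart
      ∷ inj₂ (κ-mono-≤ 2+j≤n+r)
      ∷ inj₂ (κ-mono-≤ (≤-trans 2+j≤n (≤-trans (m≤m+n n n) (m≤m+n (n + n) r))))
      ∷ [])
      where
      r = toℕ i′
      2+j≤n+r = ≤-trans 2+j≤n (m≤m+n n r)
    ... | 1ℙ = first-gap⇒¬alternate (a i) (c i′) (keys-a-odd i eq) odd-ordered₁₂ odd-ordered₂₃ refl
      ( inj₁ (<⇒≤ (κ-monoˡ-< (<-≤-trans (toℕ<n i′) (m≤m+n n j))))
      ∷ [ (λ r<j → inj₁ (<⇒≤ (κ-monoˡ-< (+-monoʳ-< n r<j)))) , (λ 2+j≤r → inj₂ (κ-mono-≤ (+-monoʳ-≤ n 2+j≤r))) ]′ apart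
      ∷ inj₂ (κ-mono-≤ (n+-≤-n+n+ (≤-trans 2+j≤n (m≤m+n n (toℕ i′)))))
      ∷ [])

    ¬alternate-a-b₁ : ¬ Alt (a i) b₁
    ¬alternate-a-b₁ with parity j in eq | 2 + j <? last
    ... | 0ℙ | yes 2+j<last = first-gap⇒¬alternate (a i) b₁ (keys-a-even i eq) even-ordered₁₂ even-ordered₂₃ refl
      ( inj₁ (κ-mono-≤ z≤n)
      ∷ inj₂ (<⇒≤ (κ-monoˡ-< 2+j<last))
      ∷ inj₂ (κ-mono-≤ (≤-trans 2+j≤n (m≤m+n n n)))
      ∷ [])
    ... | 0ℙ | no 2+j≮last = second-gap⇒¬alternate (a i) b₁ (keys-a-even i eq) even-ordered₁₂ even-ordered₂₃ refl
      ( inj₁ (κ-mono-≤ z≤n)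
      ∷ inj₁ (κ-mono-≤ (≮⇒≥ 2+j≮last))
      ∷ inj₂ (κ-mono-≤ (+-monoʳ-≤ n 2+j≤n))
      ∷ [])
    ... | 1ℙ | _ = ¬alternate-comm _≟F_ b₁ (a i) word $
      first-gap⇒¬alternate b₁ (a i) refl b₁-ordered₁₂ b₁-ordered₂₃ (keys-a-odd i eq)
      ( inj₂ (κ-mono-≤ (last≤n+ j))
      ∷ inj₂ (κ-mono-≤ (last≤n+ (2 + j)))
      ∷ inj₂ (κ-mono-≤ (≤-trans (last≤n+ n) (m≤m+n (n + n) (2 + j))))
      ∷ [])

    ¬alternate-a-b₂ : ¬ Alt (a i) b₂
    ¬alternate-a-b₂ with parity j in eq
    ... | 0ℙ = ¬alternate-comm _≟F_ b₂ (a i) word $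
      second-gap⇒¬alternate b₂ (a i) refl b₂-ordered₁₂ b₂-ordered₂₃ (keys-a-even i eq)
      ( inj₁ (<⇒≤ (κ-monoˡ-< (s≤s (≤-trans (<⇒≤ j<2+j) (≤-trans 2+j≤n n≤n+n)))))
      ∷ inj₁ (<⇒≤ (κ-monoˡ-< (s≤s (≤-trans 2+j≤n n≤n+n))))
      ∷ inj₁ (<⇒≤ (κ-monoˡ-< (s≤s (+-monoʳ-≤ n 2+j≤n))))
      ∷ [])
      where
      n≤n+n : n ≤ n + n
      n≤n+n = m≤m+n n n
    ... | 1ℙ = first-gap⇒¬alternate (a i) b₂ (keys-a-odd i eq) odd-ordered₁₂ odd-ordered₂₃ refl
      ( inj₁ (κ-mono-≤ (m≤m+n n j))
      ∷ inj₂ (<⇒≤ (κ-monoˡ-< n+2+j<1+2n))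
      ∷ inj₂ (<⇒≤ (κ-monoˡ-< (<-trans n+2+j<1+2n 1+2n<3n)))
      ∷ [])
      where
      n+2+j<1+2n : n + (2 + j) < suc (n + n)
      n+2+j<1+2n = s≤s (+-monoʳ-≤ n 2+j≤n)

    ¬alternate-a-a-even-odd : ∀ (i′ : Fin last) → parity j ≡ 0ℙ → parity (toℕ i′) ≡ 1ℙ →
                              ¬ Alt (a i) (a i′)
    ¬alternate-a-a-even-odd i′ even odd =
      first-gap⇒¬alternate (a i) (a i′) (keys-a-even i even) even-ordered₁₂ even-ordered₂₃ (keys-a-odd i′ odd)
        ( inj₂ (κ-mono-≤ (≤-trans 2+j≤n (m≤m+n n v)))
        ∷ inj₂ (κ-mono-≤ (≤-trans 2+j≤n (m≤m+n n (2 + v))))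
        ∷ inj₂ (κ-mono-≤ (≤-trans 2+j≤n (≤-trans (m≤m+n n n) (m≤m+n (n + n) (2 + v)))))
        ∷ [])
      where v = toℕ i′

    ¬alternate-a-a-same : ∀ (i′ : Fin last) → parity j ≡ parity (toℕ i′) → j < toℕ i′ →
                          ¬ Alt (a i) (a i′)
    ¬alternate-a-a-same i′ same j<v with parity j in eq
    ... | 0ℙ = first-gap⇒¬alternate (a i) (a i′) (keys-a-even i eq) even-ordered₁₂ even-ordered₂₃ (keys-a-even i′ (sym same))
      ( inj₂ (κ-mono-≤ 2+j≤v)
      ∷ inj₂ (κ-mono-≤ (≤-trans 2+j≤v (m≤n+m v 2)))
      ∷ inj₂ (κ-mono-≤ (≤-trans 2+j≤n (m≤m+n n (2 + v))))
      ∷ [])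
      where
      v = toℕ i′
      2+j≤v = same-parity⇒2+≤ (trans eq same) j<v
    ... | 1ℙ = first-gap⇒¬alternate (a i) (a i′) (keys-a-odd i eq) odd-ordered₁₂ odd-ordered₂₃ (keys-a-odd i′ (sym same))
      ( inj₂ (κ-mono-≤ (+-monoʳ-≤ n 2+j≤v))
      ∷ inj₂ (κ-mono-≤ (+-monoʳ-≤ n (≤-trans 2+j≤v (m≤n+m v 2))))
      ∷ inj₂ (κ-mono-≤ (n+-≤-n+n+ (≤-trans 2+j≤n (m≤m+n n (2 + v)))))
      ∷ [])
      where
      v = toℕ i′
      2+j≤v = same-parity⇒2+≤ (trans eq same) j<v

  ¬alternate-a-a-< : ∀ (i i′ : Fin last) → toℕ i < toℕ i′ → ¬ Alt (a i) (a i′)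
  ¬alternate-a-a-< i i′ u<v with parity (toℕ i) in e | parity (toℕ i′) in e′
  ... | 0ℙ | 1ℙ = ¬alternate-a-a-even-odd i i′ e e′
  ... | 1ℙ | 0ℙ = ¬alternate-comm _≟F_ (a i′) (a i) word (¬alternate-a-a-even-odd i′ i e′ e)
  ... | 0ℙ | 0ℙ = ¬alternate-a-a-same i i′ (trans e (sym e′)) u<v
  ... | 1ℙ | 1ℙ = ¬alternate-a-a-same i i′ (trans e (sym e′)) u<v

  ¬alternate-a-a : ∀ (i i′ : Fin last) → i ≢ i′ → ¬ Alt (a i) (a i′)
  ¬alternate-a-a i i′ i≢i′ with <-cmp (toℕ i) (toℕ i′)
  ... | tri< u<v _ _ = ¬alternate-a-a-< i i′ u<v
  ... | tri≈ _ u≡v _ = contradiction (toℕ-injective u≡v) i≢i′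
  ... | tri> _ _ v<u = ¬alternate-comm _≟F_ (a i′) (a i) word (¬alternate-a-a-< i′ i v<u)

  ⇔-alternate-comm : ∀ {A : Set} x y → A ⇔ Alt x y → A ⇔ Alt y x
  ⇔-alternate-comm x y A⇔alt =
    mk⇔ (alternate-comm _≟F_ x y word ∘ Equivalence.to A⇔alt) (Equivalence.from A⇔alt ∘ alternate-comm _≟F_ y x word)

  nonadjacent : ∀ {x y} → ¬ Alt x y → ⊥ ⇔ Alt x y
  nonadjacent ¬alt = mk⇔ ⊥-elim ¬alt

  adjacent-c-c : ∀ (i i′ : Fin n) → i ≢ i′ → Alt (c i) (c i′)
  adjacent-c-c i i′ i≢i′ with <-cmp (toℕ i) (toℕ i′)
  ... | tri< r<s _ _ = alternate-c-c i i′ r<s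
  ... | tri≈ _ r≡s _ = contradiction (toℕ-injective r≡s) i≢i′
  ... | tri> _ _ s<r = alternate-comm _≟F_ (c i′) (c i) word (alternate-c-c i′ i s<r)

  adjacent-b₁-c : ∀ (i : Fin n) → F₁E k b₁ (c i) ⇔ Alt b₁ (c i)
  adjacent-b₁-c i = mk⇔
    (λ ¬1+r≡n → alternate-b₁-c i (≤∧≢⇒< (≤-pred (toℕ<n i)) (¬1+r≡n ∘ cong suc)))
    (λ alt 1+r≡n → ¬alternate-b₁-c i (suc-injective 1+r≡n) alt)

  adjacent-b₂-c : ∀ (i : Fin n) → F₁E k b₂ (c i) ⇔ Alt b₂ (c i)
  adjacent-b₂-c i = mk⇔
    (λ r≢0 → alternate-comm _≟F_ (c i) b₂ word (alternate-c-b₂ i (≤∧≢⇒< z≤n (r≢0 ∘ sym))))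
    (λ alt r≡0 → ¬alternate-b₂-c i r≡0 alt)

  adjacent-a-c : ∀ (i : Fin last) (i′ : Fin n) → F₁E k (a i) (c i′) ⇔ Alt (a i) (c i′)
  adjacent-a-c i i′ = mk⇔ to from
    where
    to : AC {k} i i′ → Alt (a i) (c i′)
    to near with parity (toℕ i) in eq | near⇒bounds near
    ... | 0ℙ | j≤r , r<2+j = alternate-a-c-even i eq i′ j≤r r<2+j
    ... | 1ℙ | j≤r , r<2+j = alternate-comm _≟F_ (c i′) (a i) word (alternate-c-a-odd i eq i′ j≤r r<2+j)
    from : Alt (a i) (c i′) → AC {k} i i′
    from alt with near-or-apart (toℕ i′) (toℕ i)
    ... | inj₁ near  = near
    ... | inj₂ apart = contradiction alt (¬alternate-a-c i i′ apart)

  adjacent⇔alternate : ∀ x y → x ≢ y → F₁E k x y ⇔ Alt x y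
  adjacent⇔alternate (c i) (c i′) c≢c = mk⇔ (λ _ → adjacent-c-c i i′ (c≢c ∘ cong c)) (λ _ i≡i′ → c≢c (cong c i≡i′))
  adjacent⇔alternate (c i) b₁     _   = ⇔-alternate-comm b₁ (c i) (adjacent-b₁-c i)
  adjacent⇔alternate (c i) b₂     _   = ⇔-alternate-comm b₂ (c i) (adjacent-b₂-c i)
  adjacent⇔alternate (c i) (a i′) _   = ⇔-alternate-comm (a i′) (c i) (adjacent-a-c i′ i)
  adjacent⇔alternate b₁ (c i)     _   = adjacent-b₁-c i
  adjacent⇔alternate b₁ b₁        b≢b = contradiction refl b≢b
  adjacent⇔alternate b₁ b₂        _   = nonadjacent ¬alternate-b₁-b₂
  adjacent⇔alternate b₁ (a i)     _   = nonadjacent (¬alternate-comm _≟F_ (a i) b₁ word (¬alternate-a-b₁ i))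
  adjacent⇔alternate b₂ (c i)     _   = adjacent-b₂-c i
  adjacent⇔alternate b₂ b₁        _   = nonadjacent (¬alternate-comm _≟F_ b₁ b₂ word ¬alternate-b₁-b₂)
  adjacent⇔alternate b₂ b₂        b≢b = contradiction refl b≢b
  adjacent⇔alternate b₂ (a i)     _   = nonadjacent (¬alternate-comm _≟F_ (a i) b₂ word (¬alternate-a-b₂ i))
  adjacent⇔alternate (a i) (c i′) _   = adjacent-a-c i i′
  adjacent⇔alternate (a i) b₁     _   = nonadjacent (¬alternate-a-b₁ i)
  adjacent⇔alternate (a i) b₂     _   = nonadjacent (¬alternate-a-b₂ i)
  adjacent⇔alternate (a i) (a i′) a≢a = nonadjacent (¬alternate-a-a i i′ (a≢a ∘ cong a))

  ∈-word-all : ∀ v → v ∈ word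
  ∈-word-all (c i) = ∈-word (here refl)
  ∈-word-all b₁    = ∈-word (here refl)
  ∈-word-all b₂    = ∈-word (here refl)
  ∈-word-all (a i) with parity (toℕ i) in eq
  ... | 0ℙ = ∈-word (subst (κ (toℕ i) 6 ∈_) (sym (keys-a-even i eq)) (here refl))
  ... | 1ℙ = ∈-word (subst (κ (n + toℕ i) 7 ∈_) (sym (keys-a-odd i eq)) (here refl))

  wordRepresentable : WordRepresentable _≟F_ (F₁E k)
  wordRepresentable = word , ∈-word-all , adjacent⇔alternate

F₁-wordRepresentable : ∀ k → 3 ≤ k → WordRepresentable (_≟F_ {k}) (F₁E k)
F₁-wordRepresentable (suc (suc (suc m))) _ = F₁Word.wordRepresentable m
F₁-wordRepresentable 0 ()
F₁-wordRepresentable 1 (s≤s ())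
F₁-wordRepresentable 2 (s≤s (s≤s ()))

lemma13 : (k : ℕ) → 5 ≤ k → k % 2 ≡ 1 → WordRepresentable (_≟F_ {k}) (F₁E k)
lemma13 k 5≤k _ = F₁-wordRepresentable k (≤-trans (s≤s (s≤s (s≤s z≤n))) 5≤k)
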